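{- Let $h_0,h_1:\mathbb{Z}^3\to\mathbb{Z}$ be discrete arrays such that for all integers $m,n\ge1$ \[ U^{(1)}\!\left(\frac{y^m}{(1+5y)^n}\right)=\frac{1}{(1+5y)^{5n-4}}\sum_{r\ge\lceil m/5\rceil}h_1(m,n,r)\,5^{\pi_1(m,r)}\,y^r,\qquad U^{(0)}\!\left(\frac{y^m}{(1+5y)^n}\right)=\frac{1}{(1+5y)^{5n-2}}\sum_{r\ge\lceil (m+2)/5\rceil}h_0(m,n,r)\,5^{\pi_0(m,r)}\,y^r. \] Then for all $n\in\mathbb{Z}_{\ge1}$: $h_0(1,n,1)\equiv1$, $h_0(2,5n-4,1)\equiv0$, $h_0(3,n,1)\equiv1$, $h_0(1,n,2)\equiv4$, $h_0(2,5n-4,2)\equiv4$, $h_0(3,n,2)\equiv4$, $h_0(2,5n-4,3)\equiv1 \pmod 5$; and for all $n\in\mathbb{Z}_{\ge1}$ and $1\le m\le3$: $h_1(m,n,1)\equiv1\pmod5$.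
   Context: $q=e^{2\pi i\tau}$, $E_2(\tau)=1-24\sum_{n\ge1}\frac{nq^n}{1-q^n}$, $F(\tau)=\frac1{24}(50E_2(10\tau)-25E_2(5\tau)-2E_2(2\tau)+E_2(\tau))$, $Z(\tau)=q^2\prod_{m\ge1}\frac{1-q^{50m}}{1-q^{2m}}$, $y=y(\tau)=q\prod_{m\ge1}\frac{(1-q^{2m})(1-q^{10m})^3}{(1-q^m)^3(1-q^{5m})}$. For $f=\sum_{m\ge M}a(m)q^m$, $U_5(f)=\sum_{5m\ge M}a(5m)q^m$; $U^{(1)}(f)=U_5(Ff)/F$, $U^{(0)}(f)=U_5(FZf)/F$. A discrete array is a map $h:\mathbb{Z}^3\to\mathbb{Z}$ such that for each fixed $(a,b)$, $h(a,b,r)=0$ for all sufficiently large $r$. For $m,r\ge1$: $\pi_1(m,r)=0$ if $m\in\{1,2\},r=1$; $=3$ if $m\in\{1,2\},r=3$; $=\lfloor\frac{5r+1}{6}\rfloor$ if $m\in\{1,2\}$, $r\ge2$, $r\ne3$; $=2$ if $m=3,r=2$; $=\lfloor\frac{5r-2}{6}\rfloor$ if $m=3,r\ne2$; $=\lfloor\frac{5r-m+1}{6}\rfloor$ if $m\ge4$. $\pi_0(m,r)=\lfloor\frac{5r+1}{6}\rfloor$ if $m=1$, or if $m=2$ and $r\notin\{3,4,5\}$; $=\lfloor\frac{5r-5}{6}\rfloor$ if $m=2$ and $3\le r\le5$; $=\lfloor\frac{5r-m-2}{6}\rfloor$ if $m\ge3$. -}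

module Defs where

open import Data.Bool using (Bool; true; false; if_then_else_)
open import Data.Nat as ℕ using (ℕ; zero; suc; _≡ᵇ_; _≤ᵇ_; _∸_; NonZero)
open import Data.Nat.DivMod using (_/_; _%_)
open import Data.Integer as ℤ using (ℤ; +_)
open import Data.Integer.Divisibility as ℤD using ()
open import Data.Rational as ℚ using (ℚ; 0ℚ; 1ℚ)
open import Data.Product using (∃)
open import Relation.Binary.PropositionalEquality using (_≡_)

-- Formal power series in q with rational coefficients:
-- a series is its coefficient function  n ↦ [q^n] f.
-- (All series occurring in the statement have no negative powers of q.)

PS : Set
PS = ℕ → ℚ

infix 4 _≈_
_≈_ : PS → PS → Set
f ≈ g = ∀ n → f n ≡ g n

ℤ→ℚ : ℤ → ℚ
ℤ→ℚ z = z ℚ./ 1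

ℕ→ℚ : ℕ → ℚ
ℕ→ℚ n = ℤ→ℚ (+ n)

sumTo : ℕ → (ℕ → ℚ) → ℚ
sumTo zero f = f 0
sumTo (suc n) f = sumTo n f ℚ.+ f (suc n)

sumFromTo : ℕ → ℕ → (ℕ → ℚ) → ℚ
sumFromTo c n f = sumTo n (λ k → if c ≤ᵇ k then f k else 0ℚ)

qpow : ℕ → PS
qpow j n = if n ≡ᵇ j then 1ℚ else 0ℚ

one : PS
one = qpow 0

infixl 6 _⊕_ _⊝_
infixl 7 _⊛_
_⊕_ : PS → PS → PS
(f ⊕ g) n = f n ℚ.+ g n

_⊝_ : PS → PS → PS
(f ⊝ g) n = f n ℚ.- g n

scale : ℚ → PS → PS
scale c f n = c ℚ.* f n

_⊛_ : PS → PS → PS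
(f ⊛ g) n = sumTo n (λ k → f k ℚ.* g (n ∸ k))

pow : PS → ℕ → PS
pow f zero = one
pow f (suc k) = f ⊛ pow f k

-- Multiplicative inverse of a series a with constant term 1:
-- b_0 = 1, b_n = - Σ_{j=1}^{n} a_j b_{n-j}.
-- invApprox a N has correct coefficients b_0..b_N.
invApprox : PS → ℕ → PS
invApprox a zero k = one k
invApprox a (suc N) k =
  if k ≡ᵇ suc N
  then ℚ.- sumFromTo 1 (suc N) (λ j → a j ℚ.* invApprox a N (suc N ∸ j))
  else invApprox a N k

inv : PS → PS
inv a n = invApprox a n n

-- substitution q ↦ q^k   (f(τ) ↦ f(kτ))
subst-q : (k : ℕ) → .{{NonZero k}} → PS → PS
subst-q k f n = if (n % k) ≡ᵇ 0 then f (n / k) else 0ℚ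

-- E_2(τ) = 1 - 24 Σ_{n≥1} n q^n/(1-q^n).
-- The coefficient of q^N only receives contributions from n ≤ N.

lambertSum : PS
lambertSum N = sumFromTo 1 N (λ n → scale (ℕ→ℚ n) (qpow n ⊛ inv (one ⊝ qpow n)) N)

E2 : PS
E2 = one ⊝ scale (ℕ→ℚ 24) lambertSum

F : PS
F = scale (+ 1 ℚ./ 24)
      (scale (ℕ→ℚ 50) (subst-q 10 E2) ⊝ scale (ℕ→ℚ 25) (subst-q 5 E2)
        ⊝ scale (ℕ→ℚ 2) (subst-q 2 E2) ⊕ E2)

partialProd : ℕ → ℕ → PS
partialProd k zero = one
partialProd k (suc M) = partialProd k M ⊛ (one ⊝ qpow (k ℕ.* suc M))

-- ∏_{m≥1} (1 - q^{k m})  for k ≥ 1: the coefficient of q^N only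
-- depends on the factors with m ≤ N.
euler : (k : ℕ) → .{{NonZero k}} → PS
euler k N = partialProd k N N

Z : PS
Z = qpow 2 ⊛ euler 50 ⊛ inv (euler 2)

y : PS
y = qpow 1 ⊛ euler 2 ⊛ pow (euler 10) 3 ⊛ inv (pow (euler 1) 3 ⊛ euler 5)

U5 : PS → PS
U5 f m = f (5 ℕ.* m)

U⁽¹⁾ : PS → PS
U⁽¹⁾ f = U5 (F ⊛ f) ⊛ inv F

U⁽⁰⁾ : PS → PS
U⁽⁰⁾ f = U5 (F ⊛ Z ⊛ f) ⊛ inv F

onePlus5y : PS
onePlus5y = one ⊕ scale (ℕ→ℚ 5) y

base : ℕ → ℕ → PS
base m n = pow y m ⊛ inv (pow onePlus5y n)

-- π_1, π_0 (used for m, r ≥ 1; in the range r ≥ ⌈m/5⌉ resp.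
-- r ≥ ⌈(m+2)/5⌉ where they are used, all numerators are ≥ 0, so
-- truncated subtraction ∸ and ℕ-division give the exact floors).

π₁ : ℕ → ℕ → ℕ
π₁ m r with m ≤ᵇ 2 | m ≡ᵇ 3
... | true | _ = if r ≡ᵇ 1 then 0 else if r ≡ᵇ 3 then 3 else (5 ℕ.* r ℕ.+ 1) / 6
... | false | true = if r ≡ᵇ 2 then 2 else (5 ℕ.* r ∸ 2) / 6
... | false | false = (5 ℕ.* r ℕ.+ 1 ∸ m) / 6

π₀ : ℕ → ℕ → ℕ
π₀ m r with m ≤ᵇ 1 | m ≡ᵇ 2
... | true | _ = (5 ℕ.* r ℕ.+ 1) / 6
... | false | true = if (3 ≤ᵇ r) ∧' (r ≤ᵇ 5) then (5 ℕ.* r ∸ 5) / 6 else (5 ℕ.* r ℕ.+ 1) / 6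
  where
  _∧'_ : Bool → Bool → Bool
  true ∧' b = b
  false ∧' _ = false
... | false | false = (5 ℕ.* r ∸ (m ℕ.+ 2)) / 6

ceil5 : ℕ → ℕ
ceil5 x = (x ℕ.+ 4) / 5

Array : Set
Array = ℤ → ℤ → ℤ → ℤ

DiscreteArray : Array → Set
DiscreteArray h = ∀ a b → ∃ λ R → ∀ r → R ℤ.≤ r → h a b r ≡ + 0

-- Σ_{r ≥ c} h(m,n,r) 5^{π(m,r)} y^r   (formal sum; since y^r = q^r + …,
-- only r ≤ N contribute to the coefficient of q^N)
hSum : Array → (ℕ → ℕ → ℕ) → ℕ → ℕ → ℕ → PS
hSum h π c m n N =
  sumFromTo c N (λ r → ℤ→ℚ (h (+ m) (+ n) (+ r)) ℚ.* ℕ→ℚ (5 ℕ.^ π m r) ℚ.* pow y r N)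

rhs₁ : Array → ℕ → ℕ → PS
rhs₁ h m n = inv (pow onePlus5y (5 ℕ.* n ∸ 4)) ⊛ hSum h π₁ (ceil5 m) m n

rhs₀ : Array → ℕ → ℕ → PS
rhs₀ h m n = inv (pow onePlus5y (5 ℕ.* n ∸ 2)) ⊛ hSum h π₀ (ceil5 (m ℕ.+ 2)) m n

infix 4 _≡_[mod5]
_≡_[mod5] : ℤ → ℤ → Set
a ≡ b [mod5] = (+ 5) ℤD.∣ (a ℤ.- b)

{-# OPTIONS --safe #-}
-- Only the coefficients of q¹, q², q³ of both sides matter. F, Z and y have integral
-- coefficients, which are evaluated up to q¹⁵. Modulo 25, (1 + 5y)⁻ᵏ ≡ 1 − 5ky, so
-- U(yᵐ/(1 + 5y)ᵏ) ≡ A − 5k B for integer series A, B that do not depend on k. On the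
-- right-hand side (1 + 5y)^{−e} ≡ 1 modulo 5 multiplies Σ h(m,n,r) 5^{π(m,r)} yʳ, whose
-- weights 5^{π(m,r)} are constant for 1 ≤ r ≤ 3. Since y = q + O(q²), comparing coefficients
-- gives a unitriangular system for h(m,n,1), h(m,n,2), h(m,n,3) modulo 5, solved by
-- evaluating A and B.
module Submission where

open import Defs
open import Data.Nat using (ℕ; _≤_; _*_; _∸_)
open import Data.Integer using (+_)
open import Data.Product using (_×_)

open import Data.Bool using (true; false; if_then_else_; T)
open import Data.Integer as ℤ using (ℤ; _/ℕ_)
import Data.Integer.Properties as ℤP
open import Data.Integer.Divisibility.Signed
  using ( _∣_; _∣?_; divides; ∣-trans; ∣-reflexive; ∣m∣n⇒∣m+n; ∣m⇒∣-m; ∣n⇒∣m*n; ∣m⇒∣m*n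
        ; *-cancelʳ-∣; 0∣⇒≡0; ∣⇒∣ᵤ)
open import Data.Integer.Tactic.RingSolver using (solve-∀)
open import Data.List using (List; []; _∷_; reverse)
open import Data.Nat as ℕ using (zero; suc; _<_; z≤n; s≤s; _≡ᵇ_; _≤ᵇ_; NonZero)
import Data.Nat.Properties as ℕP
open import Data.Nat.DivMod using (m/n≤m)
open import Data.Nat.Divisibility using () renaming (_∣?_ to _ℕ∣?_)
open import Data.Product using (_,_)
open import Data.Rational as ℚ using (ℚ; 0ℚ; 1ℚ)
import Data.Rational.Properties as ℚP
open import Data.Rational.Unnormalised as ℚᵘ using (mkℚᵘ; *≡*) renaming (_≃_ to _≃ᵘ_)
import Data.Rational.Unnormalised.Properties as ℚᵘP
open import Data.Sum using (inj₁; inj₂)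
open import Data.Unit using (tt)
open import Function using (_∘_)
open import Relation.Binary.PropositionalEquality
open import Relation.Nullary using (Dec; does; map′; _→-dec_)
open import Relation.Nullary.Decidable using (True; toWitness)
open import Relation.Unary using (Decidable)

toℚᵘ-ℤ→ℚ : ∀ a → ℚ.toℚᵘ (ℤ→ℚ a) ≃ᵘ mkℚᵘ a 0
toℚᵘ-ℤ→ℚ a = ℚP.toℚᵘ-fromℚᵘ (mkℚᵘ a 0)

ℤ→ℚ-≃ : ∀ {a p} → mkℚᵘ a 0 ≃ᵘ ℚ.toℚᵘ p → ℤ→ℚ a ≡ p
ℤ→ℚ-≃ {a} eq = ℚP.toℚᵘ-injective (ℚᵘP.≃-trans (toℚᵘ-ℤ→ℚ a) eq)

ℤ→ℚ-+ : ∀ a b → ℤ→ℚ (a ℤ.+ b) ≡ ℤ→ℚ a ℚ.+ ℤ→ℚ b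
ℤ→ℚ-+ a b = ℤ→ℚ-≃ (begin
  mkℚᵘ (a ℤ.+ b) 0                      ≈⟨ *≡* (cong (ℤ._* + 1) (sym (cong₂ ℤ._+_ a*1≡a b*1≡b))) ⟩
  mkℚᵘ a 0 ℚᵘ.+ mkℚᵘ b 0                ≈⟨ ℚᵘP.+-cong (toℚᵘ-ℤ→ℚ a) (toℚᵘ-ℤ→ℚ b) ⟨
  ℚ.toℚᵘ (ℤ→ℚ a) ℚᵘ.+ ℚ.toℚᵘ (ℤ→ℚ b)  ≈⟨ ℚP.toℚᵘ-homo-+ (ℤ→ℚ a) (ℤ→ℚ b) ⟨
  ℚ.toℚᵘ (ℤ→ℚ a ℚ.+ ℤ→ℚ b)             ∎)
  where
  open ℚᵘP.≃-Reasoning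
  a*1≡a = ℤP.*-identityʳ a
  b*1≡b = ℤP.*-identityʳ b

ℤ→ℚ-* : ∀ a b → ℤ→ℚ (a ℤ.* b) ≡ ℤ→ℚ a ℚ.* ℤ→ℚ b
ℤ→ℚ-* a b = ℤ→ℚ-≃ (begin
  mkℚᵘ (a ℤ.* b) 0                      ≈⟨ ℚᵘP.*-cong (toℚᵘ-ℤ→ℚ a) (toℚᵘ-ℤ→ℚ b) ⟨
  ℚ.toℚᵘ (ℤ→ℚ a) ℚᵘ.* ℚ.toℚᵘ (ℤ→ℚ b)  ≈⟨ ℚP.toℚᵘ-homo-* (ℤ→ℚ a) (ℤ→ℚ b) ⟨
  ℚ.toℚᵘ (ℤ→ℚ a ℚ.* ℤ→ℚ b)             ∎)
  where open ℚᵘP.≃-Reasoning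

ℤ→ℚ-neg : ∀ a → ℤ→ℚ (ℤ.- a) ≡ ℚ.- ℤ→ℚ a
ℤ→ℚ-neg a = ℤ→ℚ-≃ (ℚᵘP.≃-trans (ℚᵘP.-‿cong (ℚᵘP.≃-sym (toℚᵘ-ℤ→ℚ a)))
                                (ℚᵘP.≃-sym (ℚP.toℚᵘ-homo‿- (ℤ→ℚ a))))

ℤ→ℚ-injective : ∀ {a b} → ℤ→ℚ a ≡ ℤ→ℚ b → a ≡ b
ℤ→ℚ-injective {a} {b} eq with ℚᵘP.≃-trans (ℚᵘP.≃-sym (toℚᵘ-ℤ→ℚ a))
                                          (ℚᵘP.≃-trans (ℚP.toℚᵘ-cong eq) (toℚᵘ-ℤ→ℚ b))
... | *≡* a*1≡b*1 = trans (sym (ℤP.*-identityʳ a)) (trans a*1≡b*1 (ℤP.*-identityʳ b))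

infix 4 _≡_[mod_]
record _≡_[mod_] (a b d : ℤ) : Set where
  constructor congruent
  field divides-difference : d ∣ a ℤ.- b
open _≡_[mod_]

congruent-via : ∀ {d x a b} → x ≡ a ℤ.- b → d ∣ x → a ≡ b [mod d ]
congruent-via refl d∣x = congruent d∣x

mod-refl : ∀ {d} a → a ≡ a [mod d ]
mod-refl a = congruent (divides (+ 0) (ℤP.+-inverseʳ a))

≡⇒≡[mod] : ∀ {d a b} → a ≡ b → a ≡ b [mod d ]
≡⇒≡[mod] {a = a} refl = mod-refl a

mod-sym : ∀ {d a b} → a ≡ b [mod d ] → b ≡ a [mod d ]
mod-sym {a = a} {b} (congruent d∣) = congruent-via (lemma a b) (∣m⇒∣-m d∣)
  where
  lemma : ∀ a b → ℤ.- (a ℤ.- b) ≡ b ℤ.- a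
  lemma = solve-∀

mod-trans : ∀ {d a b c} → a ≡ b [mod d ] → b ≡ c [mod d ] → a ≡ c [mod d ]
mod-trans {a = a} {b} {c} (congruent d∣) (congruent d∣′) =
  congruent-via (lemma a b c) (∣m∣n⇒∣m+n d∣ d∣′)
  where
  lemma : ∀ a b c → (a ℤ.- b) ℤ.+ (b ℤ.- c) ≡ a ℤ.- c
  lemma = solve-∀

mod-+ : ∀ {d a b a′ b′} → a ≡ a′ [mod d ] → b ≡ b′ [mod d ] → a ℤ.+ b ≡ a′ ℤ.+ b′ [mod d ]
mod-+ {a = a} {b} {a′} {b′} (congruent d∣) (congruent d∣′) =
  congruent-via (lemma a b a′ b′) (∣m∣n⇒∣m+n d∣ d∣′)
  where
  lemma : ∀ a b a′ b′ → (a ℤ.- a′) ℤ.+ (b ℤ.- b′) ≡ (a ℤ.+ b) ℤ.- (a′ ℤ.+ b′)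
  lemma = solve-∀

mod-+-cancelˡ : ∀ {d a b a′ b′} → a ≡ a′ [mod d ] → a ℤ.+ b ≡ a′ ℤ.+ b′ [mod d ] →
                b ≡ b′ [mod d ]
mod-+-cancelˡ {a = a} {b} {a′} {b′} (congruent d∣) (congruent d∣′) =
  congruent-via (lemma a b a′ b′) (∣m∣n⇒∣m+n d∣′ (∣m⇒∣-m d∣))
  where
  lemma : ∀ a b a′ b′ → ((a ℤ.+ b) ℤ.- (a′ ℤ.+ b′)) ℤ.+ ℤ.- (a ℤ.- a′) ≡ b ℤ.- b′
  lemma = solve-∀

mod-neg : ∀ {d a b} → a ≡ b [mod d ] → ℤ.- a ≡ ℤ.- b [mod d ]
mod-neg {a = a} {b} (congruent d∣) = congruent-via (lemma a b) (∣m⇒∣-m d∣)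
  where
  lemma : ∀ a b → ℤ.- (a ℤ.- b) ≡ ℤ.- a ℤ.- ℤ.- b
  lemma = solve-∀

mod-* : ∀ {d a b a′ b′} → a ≡ a′ [mod d ] → b ≡ b′ [mod d ] → a ℤ.* b ≡ a′ ℤ.* b′ [mod d ]
mod-* {a = a} {b} {a′} {b′} (congruent d∣) (congruent d∣′) =
  congruent-via (lemma a b a′ b′) (∣m∣n⇒∣m+n (∣n⇒∣m*n a d∣′) (∣m⇒∣m*n b′ d∣))
  where
  lemma : ∀ a b a′ b′ → a ℤ.* (b ℤ.- b′) ℤ.+ (a ℤ.- a′) ℤ.* b′ ≡ a ℤ.* b ℤ.- a′ ℤ.* b′
  lemma = solve-∀

∣-* : ∀ {d e a b} → d ∣ a → e ∣ b → d ℤ.* e ∣ a ℤ.* b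
∣-* {d} {e} (divides p refl) (divides q refl) = divides (p ℤ.* q) (lemma p d q e)
  where
  lemma : ∀ p d q e → p ℤ.* d ℤ.* (q ℤ.* e) ≡ p ℤ.* q ℤ.* (d ℤ.* e)
  lemma = solve-∀

mod-*-∣ : ∀ {d e a a′ b} → a ≡ a′ [mod d ] → e ∣ b → a ℤ.* b ≡ a′ ℤ.* b [mod d ℤ.* e ]
mod-*-∣ {a = a} {a′} {b} (congruent d∣) e∣b = congruent-via (lemma a a′ b) (∣-* d∣ e∣b)
  where
  lemma : ∀ a a′ b → (a ℤ.- a′) ℤ.* b ≡ a ℤ.* b ℤ.- a′ ℤ.* b
  lemma = solve-∀

mod-weaken : ∀ {d d′ a b} → d ∣ d′ → a ≡ b [mod d′ ] → a ≡ b [mod d ]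
mod-weaken d∣d′ (congruent d′∣) = congruent (∣-trans d∣d′ d′∣)

mod-cancelʳ : ∀ {d a b} k .{{_ : ℤ.NonZero k}} → a ℤ.* k ≡ b ℤ.* k [mod d ℤ.* k ] → a ≡ b [mod d ]
mod-cancelʳ {d} {a} {b} k (congruent dk∣) = congruent (*-cancelʳ-∣ k (subst (d ℤ.* k ∣_) (lemma a b k) dk∣))
  where
  lemma : ∀ a b k → a ℤ.* k ℤ.- b ℤ.* k ≡ (a ℤ.- b) ℤ.* k
  lemma = solve-∀

mod-by : ∀ {d a b} t → a ≡ b ℤ.+ d ℤ.* t → a ≡ b [mod d ]
mod-by {d} {a} {b} t refl = congruent-via (lemma b d t) (divides t refl)
  where
  lemma : ∀ b d t → t ℤ.* d ≡ b ℤ.+ d ℤ.* t ℤ.- b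
  lemma = solve-∀

0-divisible : ∀ d → d ∣ + 0
0-divisible d = divides (+ 0) refl

ℤSeries : Set
ℤSeries = ℕ → ℤ

sumℤ : ℕ → (ℕ → ℤ) → ℤ
sumℤ zero    f = f 0
sumℤ (suc n) f = sumℤ n f ℤ.+ f (suc n)

qℤ : ℕ → ℤSeries
qℤ j n = if n ≡ᵇ j then + 1 else + 0

oneℤ : ℤSeries
oneℤ = qℤ 0

infixl 6 _+ℤ_ _-ℤ_
infixl 7 _·ℤ_ _*ℤ_

_+ℤ_ _-ℤ_ _*ℤ_ : ℤSeries → ℤSeries → ℤSeries
(f +ℤ g) n = f n ℤ.+ g n
(f -ℤ g) n = f n ℤ.- g n
(f *ℤ g) n = sumℤ n (λ k → f k ℤ.* g (n ∸ k))

_·ℤ_ : ℤ → ℤSeries → ℤSeries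
(c ·ℤ f) n = c ℤ.* f n

powℤ : ℤSeries → ℕ → ℤSeries
powℤ f zero    = oneℤ
powℤ f (suc k) = f *ℤ powℤ f k

U5ℤ : ℤSeries → ℤSeries
U5ℤ f m = f (5 ℕ.* m)

substℤ : (k : ℕ) → .{{NonZero k}} → ℤSeries → ℤSeries
substℤ k f n = if (n ℕ.% k) ≡ᵇ 0 then f (n ℕ./ k) else + 0

tabulateℤ : ℕ → ℤSeries → List ℤ
tabulateℤ zero    f = []
tabulateℤ (suc K) f = f 0 ∷ tabulateℤ K (f ∘ suc)

fromListℤ : List ℤ → ℤSeries
fromListℤ []       _       = + 0
fromListℤ (a ∷ as) zero    = a
fromListℤ (a ∷ as) (suc n) = fromListℤ as n

fromList-tabulate : ∀ K f j → j < K → fromListℤ (tabulateℤ K f) j ≡ f j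
fromList-tabulate (suc K) f zero    _         = refl
fromList-tabulate (suc K) f (suc j) (s≤s j<K) = fromList-tabulate K (f ∘ suc) j j<K

-- All series are compared in degrees ≤ 15, which U₅ turns into degrees ≤ 3.
-- Normalisation shares a series only once its coefficients are stored:
-- without memo the nested products below take exponential time to evaluate.
memo : ℤSeries → ℤSeries
memo f = fromListℤ (tabulateℤ 16 f)

memo-≡ : ∀ f j → j ≤ 15 → memo f j ≡ f j
memo-≡ f j j≤15 = fromList-tabulate 16 f j (s≤s j≤15)

sumℤ-cong : ∀ n {f g} → (∀ k → k ≤ n → f k ≡ g k) → sumℤ n f ≡ sumℤ n g
sumℤ-cong zero    f≡g = f≡g 0 z≤n
sumℤ-cong (suc n) f≡g =
  cong₂ ℤ._+_ (sumℤ-cong n (λ k k≤n → f≡g k (ℕP.m≤n⇒m≤1+n k≤n))) (f≡g (suc n) ℕP.≤-refl)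

sumℤ-mod : ∀ {d} n {f g} → (∀ k → k ≤ n → f k ≡ g k [mod d ]) → sumℤ n f ≡ sumℤ n g [mod d ]
sumℤ-mod zero    f≡g = f≡g 0 z≤n
sumℤ-mod (suc n) f≡g =
  mod-+ (sumℤ-mod n (λ k k≤n → f≡g k (ℕP.m≤n⇒m≤1+n k≤n))) (f≡g (suc n) ℕP.≤-refl)

sumℤ-+ : ∀ n f g → sumℤ n (λ k → f k ℤ.+ g k) ≡ sumℤ n f ℤ.+ sumℤ n g
sumℤ-+ zero    f g = refl
sumℤ-+ (suc n) f g = trans (cong (ℤ._+ (f (suc n) ℤ.+ g (suc n))) (sumℤ-+ n f g))
                           (lemma (sumℤ n f) (sumℤ n g) (f (suc n)) (g (suc n)))
  where
  lemma : ∀ a b c d → a ℤ.+ b ℤ.+ (c ℤ.+ d) ≡ a ℤ.+ c ℤ.+ (b ℤ.+ d)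
  lemma = solve-∀

sumℤ-* : ∀ n c f → sumℤ n (λ k → c ℤ.* f k) ≡ c ℤ.* sumℤ n f
sumℤ-* zero    c f = refl
sumℤ-* (suc n) c f = trans (cong (ℤ._+ c ℤ.* f (suc n)) (sumℤ-* n c f))
                           (sym (ℤP.*-distribˡ-+ c (sumℤ n f) (f (suc n))))

sumℤ-zero : ∀ n {f} → (∀ k → k ≤ n → f k ≡ + 0) → sumℤ n f ≡ + 0
sumℤ-zero n {f} f≡0 = trans (sumℤ-cong n f≡0) (zeros n)
  where
  zeros : ∀ n → sumℤ n (λ _ → + 0) ≡ + 0
  zeros zero    = refl
  zeros (suc n) = cong (ℤ._+ + 0) (zeros n)

sumℤ-from-1 : ∀ n f → sumℤ n (λ k → if 1 ≤ᵇ k then f k else + 0) ℤ.+ f 0 ≡ sumℤ n f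
sumℤ-from-1 zero    f = ℤP.+-identityˡ (f 0)
sumℤ-from-1 (suc n) f =
  trans (lemma (sumℤ n (λ k → if 1 ≤ᵇ k then f k else + 0)) (f (suc n)) (f 0))
        (cong (ℤ._+ f (suc n)) (sumℤ-from-1 n f))
  where
  lemma : ∀ a b c → a ℤ.+ b ℤ.+ c ≡ a ℤ.+ c ℤ.+ b
  lemma = solve-∀

∣-sumℤ : ∀ {d} n {f} → (∀ k → k ≤ n → d ∣ f k) → d ∣ sumℤ n f
∣-sumℤ zero    d∣f = d∣f 0 z≤n
∣-sumℤ (suc n) d∣f =
  ∣m∣n⇒∣m+n (∣-sumℤ n (λ k k≤n → d∣f k (ℕP.m≤n⇒m≤1+n k≤n))) (d∣f (suc n) ℕP.≤-refl)

*ℤ-identityˡ : ∀ f n → (oneℤ *ℤ f) n ≡ f n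
*ℤ-identityˡ f n = go n (λ k → f (n ∸ k))
  where
  go : ∀ m (g : ℕ → ℤ) → sumℤ m (λ k → oneℤ k ℤ.* g k) ≡ g 0
  go zero    g = ℤP.*-identityˡ (g 0)
  go (suc m) g = trans (ℤP.+-identityʳ (sumℤ m (λ k → oneℤ k ℤ.* g k))) (go m g)

*ℤ-identityʳ : ∀ f n → (f *ℤ oneℤ) n ≡ f n
*ℤ-identityʳ f zero    = ℤP.*-identityʳ (f 0)
*ℤ-identityʳ f (suc n) = begin
  sumℤ n (λ k → f k ℤ.* oneℤ (suc n ∸ k)) ℤ.+ f (suc n) ℤ.* oneℤ (n ∸ n)
    ≡⟨ cong₂ ℤ._+_ (sumℤ-zero n term-zero)
                   (trans (cong (λ i → f (suc n) ℤ.* oneℤ i) (ℕP.n∸n≡0 n)) (ℤP.*-identityʳ (f (suc n)))) ⟩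
  + 0 ℤ.+ f (suc n)
    ≡⟨ ℤP.+-identityˡ (f (suc n)) ⟩
  f (suc n) ∎
  where
  open ≡-Reasoning
  term-zero : ∀ k → k ≤ n → f k ℤ.* oneℤ (suc n ∸ k) ≡ + 0
  term-zero k k≤n rewrite ℕP.+-∸-assoc 1 k≤n = ℤP.*-zeroʳ (f k)

*ℤ-linearˡ : ∀ a c b g n → ((a +ℤ c ·ℤ b) *ℤ g) n ≡ ((a *ℤ g) +ℤ c ·ℤ (b *ℤ g)) n
*ℤ-linearˡ a c b g n =
  trans (sumℤ-cong n (λ k _ → lemma (a k) c (b k) (g (n ∸ k))))
        (trans (sumℤ-+ n _ _) (cong (λ x → (a *ℤ g) n ℤ.+ x) (sumℤ-* n c _)))
  where
  lemma : ∀ a c b g → (a ℤ.+ c ℤ.* b) ℤ.* g ≡ a ℤ.* g ℤ.+ c ℤ.* (b ℤ.* g)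
  lemma = solve-∀

*ℤ-linearʳ : ∀ g a c b n → (g *ℤ (a +ℤ c ·ℤ b)) n ≡ ((g *ℤ a) +ℤ c ·ℤ (g *ℤ b)) n
*ℤ-linearʳ g a c b n =
  trans (sumℤ-cong n (λ k _ → lemma (g k) (a (n ∸ k)) c (b (n ∸ k))))
        (trans (sumℤ-+ n _ _) (cong (λ x → (g *ℤ a) n ℤ.+ x) (sumℤ-* n c _)))
  where
  lemma : ∀ g a c b → g ℤ.* (a ℤ.+ c ℤ.* b) ≡ g ℤ.* a ℤ.+ c ℤ.* (g ℤ.* b)
  lemma = solve-∀

*ℤ-cong : ∀ n {a a′ b b′} → (∀ k → k ≤ n → a k ≡ a′ k) → (∀ k → k ≤ n → b k ≡ b′ k) →
          (a *ℤ b) n ≡ (a′ *ℤ b′) n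
*ℤ-cong n a≡ b≡ = sumℤ-cong n (λ k k≤n → cong₂ ℤ._*_ (a≡ k k≤n) (b≡ (n ∸ k) (ℕP.m∸n≤m n k)))

*ℤ-mod-∣ : ∀ {d e} n {a a′ b} → (∀ k → k ≤ n → a k ≡ a′ k [mod d ]) →
           (∀ k → k ≤ n → e ∣ b k) → (a *ℤ b) n ≡ (a′ *ℤ b) n [mod d ℤ.* e ]
*ℤ-mod-∣ n a≡ e∣b = sumℤ-mod n (λ k k≤n → mod-*-∣ (a≡ k k≤n) (e∣b (n ∸ k) (ℕP.m∸n≤m n k)))

lin-congruence : ∀ {d e J} a c c′ b → d ∣ c ℤ.- c′ → (∀ j → j ≤ J → e ∣ b j) →
                 ∀ j → j ≤ J → (a +ℤ c ·ℤ b) j ≡ (a +ℤ c′ ·ℤ b) j [mod d ℤ.* e ]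
lin-congruence a c c′ b d∣c-c′ e∣b j j≤J =
  mod-+ (mod-refl (a j)) (mod-*-∣ {a = c} {c′} (congruent d∣c-c′) (e∣b j j≤J))

-- Rational series represented by integer series modulo d

infix 4 _≋_[mod_] _≋_[mod_]upTo_

record _≋_[mod_] (x : ℚ) (b d : ℤ) : Set where
  constructor represents
  field
    value      : ℤ
    x≡value    : x ≡ ℤ→ℚ value
    value≡b    : value ≡ b [mod d ]

record _≋_[mod_]upTo_ (f : PS) (g : ℤSeries) (d : ℤ) (K : ℕ) : Set where
  constructor coefficientwise
  field at : ∀ j → j ≤ K → f j ≋ g j [mod d ]
open _≋_[mod_]upTo_

≋-ℤ→ℚ : ∀ {d} a → ℤ→ℚ a ≋ a [mod d ]
≋-ℤ→ℚ a = represents a refl (mod-refl a)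

≋-resp : ∀ {d x b b′} → b ≡ b′ [mod d ] → x ≋ b [mod d ] → x ≋ b′ [mod d ]
≋-resp b≡b′ (represents a x≡a a≡b) = represents a x≡a (mod-trans a≡b b≡b′)

≋-weaken : ∀ {d d′ x b} → d ∣ d′ → x ≋ b [mod d′ ] → x ≋ b [mod d ]
≋-weaken d∣d′ (represents a x≡a a≡b) = represents a x≡a (mod-weaken d∣d′ a≡b)

≋-unique : ∀ {d x b b′} → x ≋ b [mod d ] → x ≋ b′ [mod d ] → b ≡ b′ [mod d ]
≋-unique (represents a x≡a a≡b) (represents a′ x≡a′ a′≡b′) =
  mod-trans (mod-sym a≡b) (mod-trans (≡⇒≡[mod] (ℤ→ℚ-injective (trans (sym x≡a) x≡a′))) a′≡b′)

≋-+ : ∀ {d x y a b} → x ≋ a [mod d ] → y ≋ b [mod d ] → x ℚ.+ y ≋ a ℤ.+ b [mod d ]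
≋-+ (represents a x≡a a≡) (represents b y≡b b≡) =
  represents (a ℤ.+ b) (trans (cong₂ ℚ._+_ x≡a y≡b) (sym (ℤ→ℚ-+ a b))) (mod-+ a≡ b≡)

≋-neg : ∀ {d x a} → x ≋ a [mod d ] → ℚ.- x ≋ ℤ.- a [mod d ]
≋-neg (represents a x≡a a≡) = represents (ℤ.- a) (trans (cong ℚ.-_ x≡a) (sym (ℤ→ℚ-neg a))) (mod-neg a≡)

≋-minus : ∀ {d x y a b} → x ≋ a [mod d ] → y ≋ b [mod d ] → x ℚ.- y ≋ a ℤ.- b [mod d ]
≋-minus x≋a y≋b = ≋-+ x≋a (≋-neg y≋b)

≋-* : ∀ {d x y a b} → x ≋ a [mod d ] → y ≋ b [mod d ] → x ℚ.* y ≋ a ℤ.* b [mod d ]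
≋-* (represents a x≡a a≡) (represents b y≡b b≡) =
  represents (a ℤ.* b) (trans (cong₂ ℚ._*_ x≡a y≡b) (sym (ℤ→ℚ-* a b))) (mod-* a≡ b≡)

≋-if : ∀ {d x y a b} c → x ≋ a [mod d ] → y ≋ b [mod d ] →
       (if c then x else y) ≋ (if c then a else b) [mod d ]
≋-if true  x≋a _   = x≋a
≋-if false _   y≋b = y≋b

≋-sumTo : ∀ {d} n {f g} → (∀ k → k ≤ n → f k ≋ g k [mod d ]) → sumTo n f ≋ sumℤ n g [mod d ]
≋-sumTo zero    f≋g = f≋g 0 z≤n
≋-sumTo (suc n) f≋g =
  ≋-+ (≋-sumTo n (λ k k≤n → f≋g k (ℕP.m≤n⇒m≤1+n k≤n))) (f≋g (suc n) ℕP.≤-refl)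

≋-mono : ∀ {d K K′ f g} → K′ ≤ K → f ≋ g [mod d ]upTo K → f ≋ g [mod d ]upTo K′
≋-mono K′≤K f≋g = coefficientwise λ j j≤K′ → at f≋g j (ℕP.≤-trans j≤K′ K′≤K)

≋-resp-upTo : ∀ {d K f g g′} → (∀ j → j ≤ K → g j ≡ g′ j [mod d ]) →
          f ≋ g [mod d ]upTo K → f ≋ g′ [mod d ]upTo K
≋-resp-upTo g≡g′ f≋g = coefficientwise λ j j≤K → ≋-resp (g≡g′ j j≤K) (at f≋g j j≤K)

≋-weaken-upTo : ∀ {d d′ K f g} → d ∣ d′ → f ≋ g [mod d′ ]upTo K → f ≋ g [mod d ]upTo K
≋-weaken-upTo d∣d′ f≋g = coefficientwise λ j j≤K → ≋-weaken d∣d′ (at f≋g j j≤K)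

≋-qpow : ∀ {d K} i → qpow i ≋ qℤ i [mod d ]upTo K
≋-qpow i = coefficientwise λ j _ → ≋-if (j ≡ᵇ i) (≋-ℤ→ℚ (+ 1)) (≋-ℤ→ℚ (+ 0))

≋-⊕ : ∀ {d K f f′ g g′} → f ≋ g [mod d ]upTo K → f′ ≋ g′ [mod d ]upTo K →
      f ⊕ f′ ≋ g +ℤ g′ [mod d ]upTo K
≋-⊕ f≋g f′≋g′ = coefficientwise λ j j≤K → ≋-+ (at f≋g j j≤K) (at f′≋g′ j j≤K)

≋-⊝ : ∀ {d K f f′ g g′} → f ≋ g [mod d ]upTo K → f′ ≋ g′ [mod d ]upTo K →
      f ⊝ f′ ≋ g -ℤ g′ [mod d ]upTo K
≋-⊝ f≋g f′≋g′ = coefficientwise λ j j≤K → ≋-minus (at f≋g j j≤K) (at f′≋g′ j j≤K)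

≋-scale : ∀ {d K f g} c → f ≋ g [mod d ]upTo K → scale (ℤ→ℚ c) f ≋ c ·ℤ g [mod d ]upTo K
≋-scale c f≋g = coefficientwise λ j j≤K → ≋-* (≋-ℤ→ℚ c) (at f≋g j j≤K)

≋-⊛ : ∀ {d K f f′ g g′} → f ≋ g [mod d ]upTo K → f′ ≋ g′ [mod d ]upTo K →
      f ⊛ f′ ≋ g *ℤ g′ [mod d ]upTo K
≋-⊛ f≋g f′≋g′ = coefficientwise λ j j≤K → ≋-sumTo j λ k k≤j →
  ≋-* (at f≋g k (ℕP.≤-trans k≤j j≤K)) (at f′≋g′ (j ∸ k) (ℕP.≤-trans (ℕP.m∸n≤m j k) j≤K))

≋-pow : ∀ {d K f g} → f ≋ g [mod d ]upTo K → ∀ m → pow f m ≋ powℤ g m [mod d ]upTo K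
≋-pow f≋g zero    = ≋-qpow 0
≋-pow f≋g (suc m) = ≋-⊛ f≋g (≋-pow f≋g m)

≋-U5 : ∀ {d K f g} → f ≋ g [mod d ]upTo 5 ℕ.* K → U5 f ≋ U5ℤ g [mod d ]upTo K
≋-U5 f≋g = coefficientwise λ j j≤K → at f≋g (5 ℕ.* j) (ℕP.*-monoʳ-≤ 5 j≤K)

≋-subst-q : ∀ {d K f g} k .{{_ : NonZero k}} → f ≋ g [mod d ]upTo K → subst-q k f ≋ substℤ k g [mod d ]upTo K
≋-subst-q k f≋g = coefficientwise λ j j≤K →
  ≋-if (j ℕ.% k ≡ᵇ 0) (at f≋g (j ℕ./ k) (ℕP.≤-trans (m/n≤m j k) j≤K)) (≋-ℤ→ℚ (+ 0))

≋-memo : ∀ {d f g} → f ≋ g [mod d ]upTo 15 → f ≋ memo g [mod d ]upTo 15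
≋-memo {g = g} = ≋-resp-upTo (λ j j≤15 → ≡⇒≡[mod] (sym (memo-≡ g j j≤15)))

≋-diagonal : ∀ {d K} {f : ℕ → PS} {g : ℕ → ℤSeries} → (∀ M → f M ≋ g M [mod d ]upTo K) →
             (λ N → f N N) ≋ (λ N → g N N) [mod d ]upTo K
≋-diagonal f≋g = coefficientwise λ N N≤K → at (f≋g N) N N≤K

≋-scale-1/24 : ∀ {K f g} → f ≋ + 24 ·ℤ g [mod + 0 ]upTo K → scale (+ 1 ℚ./ 24) f ≋ g [mod + 0 ]upTo K
≋-scale-1/24 {f = f} {g} f≋24g = coefficientwise λ j j≤K → scaled j (at f≋24g j j≤K)
  where
  open ≡-Reasoning
  scaled : ∀ j → f j ≋ + 24 ℤ.* g j [mod + 0 ] → (+ 1 ℚ./ 24) ℚ.* f j ≋ g j [mod + 0 ]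
  scaled j (represents a fj≡a (congruent 0∣a-24g)) = represents (g j) (begin
    + 1 ℚ./ 24 ℚ.* f j                         ≡⟨ cong (+ 1 ℚ./ 24 ℚ.*_) fj≡a ⟩
    + 1 ℚ./ 24 ℚ.* ℤ→ℚ a                       ≡⟨ cong (λ x → + 1 ℚ./ 24 ℚ.* ℤ→ℚ x) a≡24g ⟩
    + 1 ℚ./ 24 ℚ.* ℤ→ℚ (+ 24 ℤ.* g j)          ≡⟨ cong (+ 1 ℚ./ 24 ℚ.*_) (ℤ→ℚ-* (+ 24) (g j)) ⟩
    + 1 ℚ./ 24 ℚ.* (ℤ→ℚ (+ 24) ℚ.* ℤ→ℚ (g j))
      ≡⟨ ℚP.*-assoc (+ 1 ℚ./ 24) (ℤ→ℚ (+ 24)) (ℤ→ℚ (g j)) ⟨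
    1ℚ ℚ.* ℤ→ℚ (g j)                           ≡⟨ ℚP.*-identityˡ (ℤ→ℚ (g j)) ⟩
    ℤ→ℚ (g j)                                  ∎) (mod-refl (g j))
    where
    a≡24g : a ≡ + 24 ℤ.* g j
    a≡24g = ℤP.i-j≡0⇒i≡j a (+ 24 ℤ.* g j) (0∣⇒≡0 0∣a-24g)

≡ᵇ-refl : ∀ n → (n ≡ᵇ n) ≡ true
≡ᵇ-refl zero    = refl
≡ᵇ-refl (suc n) = ≡ᵇ-refl n

<⇒≢ᵇ : ∀ {k n} → k < n → (k ≡ᵇ n) ≡ false
<⇒≢ᵇ {zero}  {suc n} _         = refl
<⇒≢ᵇ {suc k} {suc n} (s≤s k<n) = <⇒≢ᵇ k<n

invApprox-stable : ∀ a N k → k ≤ N → invApprox a N k ≡ inv a k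
invApprox-stable a N k k≤N with ℕP.m≤n⇒m<n∨m≡n k≤N
... | inj₂ refl = refl
invApprox-stable a (suc N) k _ | inj₁ k<1+N rewrite <⇒≢ᵇ k<1+N =
  invApprox-stable a N k (ℕP.≤-pred k<1+N)

inv-suc : ∀ a N → inv a (suc N) ≡ ℚ.- sumFromTo 1 (suc N) (λ j → a j ℚ.* invApprox a N (suc N ∸ j))
inv-suc a N rewrite ≡ᵇ-refl N = refl

≋-inv : ∀ {d K a g} b → a ≋ g [mod d ]upTo K → g 0 ≡ + 1 →
        (∀ j → j ≤ K → (g *ℤ b) j ≡ oneℤ j [mod d ]) → inv a ≋ b [mod d ]upTo K
≋-inv {d} {K} {a} {g} b a≋g g0≡1 gb≡1 = coefficientwise λ j j≤K → below j j≤K j ℕP.≤-refl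
  where
  gb≡b : ∀ n → g 0 ℤ.* b n ≡ b n
  gb≡b n = trans (cong (ℤ._* b n) g0≡1) (ℤP.*-identityˡ (b n))

  step : ∀ N → suc N ≤ K → (∀ j → j ≤ N → inv a j ≋ b j [mod d ]) → inv a (suc N) ≋ b (suc N) [mod d ]
  step N 1+N≤K IH = subst (_≋ b (suc N) [mod d ]) (sym (inv-suc a N))
    (≋-resp (negated (mod-trans (≡⇒≡[mod] S+b≡gb) (gb≡1 (suc N) 1+N≤K))) (≋-neg (≋-sumTo (suc N) term)))
    where
    S = sumℤ (suc N) (λ i → if 1 ≤ᵇ i then g i ℤ.* b (suc N ∸ i) else + 0)
    S+b≡gb : S ℤ.+ b (suc N) ≡ (g *ℤ b) (suc N)
    S+b≡gb = trans (cong (λ x → S ℤ.+ x) (sym (gb≡b (suc N)))) (sumℤ-from-1 (suc N) _)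
    term : ∀ i → i ≤ suc N → (if 1 ≤ᵇ i then a i ℚ.* invApprox a N (suc N ∸ i) else 0ℚ)
                             ≋ (if 1 ≤ᵇ i then g i ℤ.* b (suc N ∸ i) else + 0) [mod d ]
    term zero    _       = ≋-ℤ→ℚ (+ 0)
    term (suc i) 1+i≤1+N = ≋-* (at a≋g (suc i) (ℕP.≤-trans 1+i≤1+N 1+N≤K))
      (subst (_≋ b (N ∸ i) [mod d ]) (sym (invApprox-stable a N (N ∸ i) (ℕP.m∸n≤m N i)))
             (IH (N ∸ i) (ℕP.m∸n≤m N i)))
    negated : ∀ {x y} → x ℤ.+ y ≡ + 0 [mod d ] → ℤ.- x ≡ y [mod d ]
    negated {x} {y} (congruent d∣) = congruent-via (lemma x y) (∣m⇒∣-m d∣)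
      where
      lemma : ∀ x y → ℤ.- (x ℤ.+ y ℤ.- + 0) ≡ ℤ.- x ℤ.- y
      lemma = solve-∀

  below : ∀ N → N ≤ K → ∀ j → j ≤ N → inv a j ≋ b j [mod d ]
  below zero    _     .zero z≤n = represents (+ 1) refl
    (mod-sym (mod-trans (≡⇒≡[mod] (sym (gb≡b 0))) (gb≡1 0 z≤n)))
  below (suc N) 1+N≤K j  j≤1+N with ℕP.m≤n⇒m<n∨m≡n j≤1+N
  ... | inj₁ j<1+N = below N (ℕP.≤-trans (ℕP.n≤1+n N) 1+N≤K) j (ℕP.≤-pred j<1+N)
  ... | inj₂ refl  = step N 1+N≤K (below N (ℕP.≤-trans (ℕP.n≤1+n N) 1+N≤K))

-- Certificates checked by evaluation

byComputation : ∀ {P : ℕ → Set} (P? : Decidable P) K → {True (ℕP.allUpTo? P? (suc K))} →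
                ∀ j → j ≤ K → P j
byComputation P? K {ok} j j≤K = toWitness ok (s≤s j≤K)

_≡?_[mod_] : ∀ a b d → Dec (a ≡ b [mod d ])
a ≡? b [mod d ] = map′ congruent divides-difference (d ∣? a ℤ.- b)

-- The series are arguments of the deciders rather than free variables of a λ,
-- so that evaluation shares them across all degrees j.
congruent? : ∀ d (f g : ℤSeries) j → Dec (f j ≡ g j [mod d ])
congruent? d f g j = f j ≡? g j [mod d ]

inverse? : ∀ d (g b : ℤSeries) j → Dec ((g *ℤ b) j ≡ oneℤ j [mod d ])
inverse? d g b = congruent? d (g *ℤ b) oneℤ

constant? : ∀ (π : ℕ → ℕ → ℕ) c m w r → Dec (c ≤ r → + (5 ℕ.^ π m r) ≡ w)
constant? π c m w r = (c ℕ.≤? r) →-dec (+ (5 ℕ.^ π m r) ℤ.≟ w)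

divisible? : ∀ d (f : ℤSeries) j → Dec (d ∣ f j)
divisible? d f j = d ∣? f j

-- a candidate inverse of a series with constant term 1, certified by computation at each use
invℤ : ℤSeries → ℤSeries
invℤ g = fromListℤ (reverse (go 15))
  where
  dot : ℕ → List ℤ → ℤ
  dot i []       = + 0
  dot i (b ∷ bs) = g i ℤ.* b ℤ.+ dot (suc i) bs
  extend : List ℤ → List ℤ
  extend bs = ℤ.- dot 1 bs ∷ bs
  go : ℕ → List ℤ
  go zero    = + 1 ∷ []
  go (suc N) = extend (go N)

≋-invℤ : ∀ {a} g → a ≋ g [mod + 0 ]upTo 15 → g 0 ≡ + 1 →
         {True (ℕP.allUpTo? (inverse? (+ 0) g (invℤ g)) 16)} →
         inv a ≋ invℤ g [mod + 0 ]upTo 15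
≋-invℤ g a≋g g0≡1 {ok} = ≋-inv (invℤ g) a≋g g0≡1 (byComputation (inverse? (+ 0) g (invℤ g)) 15 {ok})

geometricℤ : ℕ → ℤSeries
geometricℤ n j = if does (n ℕ∣? j) then + 1 else + 0

inv-one-minus-qpow-≋ : ∀ n → n ≤ 14 → inv (one ⊝ qpow (suc n)) ≋ geometricℤ (suc n) [mod + 0 ]upTo 15
inv-one-minus-qpow-≋ n n≤14 = ≋-inv (geometricℤ (suc n)) (≋-⊝ (≋-qpow 0) (≋-qpow (suc n))) refl
  λ j j≤15 → byComputation (λ n → ℕP.allUpTo? (inverse? (+ 0) (oneℤ -ℤ qℤ (suc n)) (geometricℤ (suc n))) 16)
                            14 n n≤14 (s≤s j≤15)

lambertℤ : ℤSeries
lambertℤ = memo λ N → sumℤ N (λ n → if 1 ≤ᵇ n then + n ℤ.* (qℤ n *ℤ geometricℤ n) N else + 0)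

lambertSum-≋ : lambertSum ≋ lambertℤ [mod + 0 ]upTo 15
lambertSum-≋ = ≋-memo (coefficientwise λ N N≤15 →
  ≋-sumTo N {g = λ n → if 1 ≤ᵇ n then + n ℤ.* (qℤ n *ℤ geometricℤ n) N else + 0} λ where
  zero    _     → ≋-ℤ→ℚ (+ 0)
  (suc n) 1+n≤N → at (≋-scale (+ suc n) (≋-⊛ (≋-qpow (suc n)) (inv-one-minus-qpow-≋ n (n≤14 1+n≤N N≤15)))) N N≤15)
  where
  n≤14 : ∀ {n N} → suc n ≤ N → N ≤ 15 → n ≤ 14
  n≤14 1+n≤N N≤15 = ℕP.≤-pred (ℕP.≤-trans 1+n≤N N≤15)

E2ℤ : ℤSeries
E2ℤ = oneℤ -ℤ + 24 ·ℤ lambertℤ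

E2-≋ : E2 ≋ E2ℤ [mod + 0 ]upTo 15
E2-≋ = ≋-⊝ (≋-qpow 0) (≋-scale (+ 24) lambertSum-≋)

24Fℤ : ℤSeries
24Fℤ = + 50 ·ℤ substℤ 10 E2ℤ -ℤ + 25 ·ℤ substℤ 5 E2ℤ -ℤ + 2 ·ℤ substℤ 2 E2ℤ +ℤ E2ℤ

-- the division is exact: F-≋ checks 24Fℤ = 24 ·ℤ Fℤ
Fℤ : ℤSeries
Fℤ = memo λ j → 24Fℤ j /ℕ 24

F-≋ : F ≋ Fℤ [mod + 0 ]upTo 15
F-≋ = ≋-scale-1/24 (≋-resp-upTo (byComputation (congruent? (+ 0) 24Fℤ (+ 24 ·ℤ Fℤ)) 15)
  (≋-⊕ (≋-⊝ (≋-⊝ (≋-scale (+ 50) (≋-subst-q 10 E2-≋)) (≋-scale (+ 25) (≋-subst-q 5 E2-≋)))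
              (≋-scale (+ 2) (≋-subst-q 2 E2-≋)))
       E2-≋))

iFℤ : ℤSeries
iFℤ = invℤ Fℤ

inv-F-≋ : inv F ≋ iFℤ [mod + 0 ]upTo 15
inv-F-≋ = ≋-invℤ Fℤ F-≋ refl

partialProdℤ : ℕ → ℕ → ℤSeries
partialProdℤ k zero    = oneℤ
partialProdℤ k (suc M) = memo (partialProdℤ k M *ℤ (oneℤ -ℤ qℤ (k ℕ.* suc M)))

partialProd-≋ : ∀ k M → partialProd k M ≋ partialProdℤ k M [mod + 0 ]upTo 15
partialProd-≋ k zero    = ≋-qpow 0
partialProd-≋ k (suc M) = ≋-memo (≋-⊛ (partialProd-≋ k M) (≋-⊝ (≋-qpow 0) (≋-qpow (k ℕ.* suc M))))

eulerℤ : ℕ → ℤSeries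
eulerℤ k = memo λ N → partialProdℤ k N N

-- Implicit models are supplied here and below: inferring them makes unification
-- evaluate series whose parameters are unknown.
euler-≋ : ∀ k .{{_ : NonZero k}} → euler k ≋ eulerℤ k [mod + 0 ]upTo 15
euler-≋ k = ≋-memo {g = λ N → partialProdℤ k N N} (≋-diagonal (partialProd-≋ k))

Zℤ : ℤSeries
Zℤ = memo (qℤ 2 *ℤ eulerℤ 50 *ℤ invℤ (eulerℤ 2))

Z-≋ : Z ≋ Zℤ [mod + 0 ]upTo 15
Z-≋ = ≋-memo (≋-⊛ (≋-⊛ (≋-qpow 2) (euler-≋ 50)) (≋-invℤ (eulerℤ 2) (euler-≋ 2) refl))

FZℤ : ℤSeries
FZℤ = memo (Fℤ *ℤ Zℤ)

FZ-≋ : F ⊛ Z ≋ FZℤ [mod + 0 ]upTo 15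
FZ-≋ = ≋-memo (≋-⊛ F-≋ Z-≋)

denominatorℤ : ℤSeries
denominatorℤ = memo (powℤ (eulerℤ 1) 3 *ℤ eulerℤ 5)

denominator-≋ : pow (euler 1) 3 ⊛ euler 5 ≋ denominatorℤ [mod + 0 ]upTo 15
denominator-≋ = ≋-memo (≋-⊛ (≋-pow (euler-≋ 1) 3) (euler-≋ 5))

Yℤ : ℤSeries
Yℤ = memo (qℤ 1 *ℤ eulerℤ 2 *ℤ powℤ (eulerℤ 10) 3 *ℤ invℤ denominatorℤ)

y-≋ : y ≋ Yℤ [mod + 0 ]upTo 15
y-≋ = ≋-memo (≋-⊛ (≋-⊛ (≋-⊛ (≋-qpow 1) (euler-≋ 2)) (≋-pow (euler-≋ 10) 3))
                  (≋-invℤ denominatorℤ denominator-≋ refl))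

-- U(yᵐ / (1 + 5y)ᵏ) modulo 25

Yℤ^ : ℕ → ℤSeries
Yℤ^ m = memo (powℤ Yℤ m)

first-order-product : ∀ c c′ X n → ((oneℤ +ℤ c ·ℤ X) *ℤ (oneℤ +ℤ c′ ·ℤ X)) n
                                    ≡ (oneℤ +ℤ (c ℤ.+ c′) ·ℤ X) n ℤ.+ c ℤ.* c′ ℤ.* (X *ℤ X) n
first-order-product c c′ X n = begin
  ((oneℤ +ℤ c ·ℤ X) *ℤ B) n                      ≡⟨ *ℤ-linearˡ oneℤ c X B n ⟩
  (oneℤ *ℤ B) n ℤ.+ c ℤ.* (X *ℤ B) n             ≡⟨ cong₂ (λ u v → u ℤ.+ c ℤ.* v) (*ℤ-identityˡ B n) XB≡ ⟩
  B n ℤ.+ c ℤ.* (X n ℤ.+ c′ ℤ.* (X *ℤ X) n)      ≡⟨ lemma (oneℤ n) (X n) ((X *ℤ X) n) c c′ ⟩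
  (oneℤ +ℤ (c ℤ.+ c′) ·ℤ X) n ℤ.+ c ℤ.* c′ ℤ.* (X *ℤ X) n ∎
  where
  open ≡-Reasoning
  B = oneℤ +ℤ c′ ·ℤ X
  XB≡ : (X *ℤ B) n ≡ X n ℤ.+ c′ ℤ.* (X *ℤ X) n
  XB≡ = trans (*ℤ-linearʳ X oneℤ c′ X n) (cong (ℤ._+ c′ ℤ.* (X *ℤ X) n) (*ℤ-identityʳ X n))
  lemma : ∀ o x w c c′ → o ℤ.+ c′ ℤ.* x ℤ.+ c ℤ.* (x ℤ.+ c′ ℤ.* w)
                         ≡ o ℤ.+ (c ℤ.+ c′) ℤ.* x ℤ.+ c ℤ.* c′ ℤ.* w
  lemma = solve-∀

onePlus5y-≋ : onePlus5y ≋ oneℤ +ℤ + 5 ·ℤ Yℤ [mod + 0 ]upTo 15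
onePlus5y-≋ = ≋-⊕ (≋-qpow 0) (≋-scale (+ 5) y-≋)

pow-onePlus5y-≋ : ∀ k → pow onePlus5y k ≋ oneℤ +ℤ (+ 5 ℤ.* + k) ·ℤ Yℤ [mod + 25 ]upTo 15
pow-onePlus5y-≋ zero    = ≋-resp-upTo (λ j _ → ≡⇒≡[mod] (sym (ℤP.+-identityʳ (oneℤ j)))) (≋-qpow 0)
pow-onePlus5y-≋ (suc k) =
  ≋-resp-upTo step (≋-⊛ (≋-weaken-upTo (0-divisible (+ 25)) onePlus5y-≋) (pow-onePlus5y-≋ k))
  where
  step : ∀ j → j ≤ 15 → ((oneℤ +ℤ + 5 ·ℤ Yℤ) *ℤ (oneℤ +ℤ (+ 5 ℤ.* + k) ·ℤ Yℤ)) j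
                        ≡ (oneℤ +ℤ (+ 5 ℤ.* + suc k) ·ℤ Yℤ) j [mod + 25 ]
  step j _ = mod-by (+ k ℤ.* (Yℤ *ℤ Yℤ) j)
    (trans (first-order-product (+ 5) (+ 5 ℤ.* + k) Yℤ j) (lemma (oneℤ j) (Yℤ j) ((Yℤ *ℤ Yℤ) j) (+ k)))
    where
    lemma : ∀ o y w k → o ℤ.+ (+ 5 ℤ.+ + 5 ℤ.* k) ℤ.* y ℤ.+ + 5 ℤ.* (+ 5 ℤ.* k) ℤ.* w
                        ≡ o ℤ.+ (+ 5 ℤ.* (+ 1 ℤ.+ k)) ℤ.* y ℤ.+ + 25 ℤ.* (k ℤ.* w)
    lemma = solve-∀

inv-pow-onePlus5y-≋ : ∀ k → inv (pow onePlus5y k) ≋ oneℤ +ℤ ℤ.- (+ 5 ℤ.* + k) ·ℤ Yℤ [mod + 25 ]upTo 15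
inv-pow-onePlus5y-≋ k = ≋-inv (oneℤ +ℤ ℤ.- c ·ℤ Yℤ) (pow-onePlus5y-≋ k) (cong (λ x → + 1 ℤ.+ x) (ℤP.*-zeroʳ c)) inverse
  where
  c = + 5 ℤ.* + k
  inverse : ∀ j → j ≤ 15 → ((oneℤ +ℤ c ·ℤ Yℤ) *ℤ (oneℤ +ℤ ℤ.- c ·ℤ Yℤ)) j ≡ oneℤ j [mod + 25 ]
  inverse j _ = mod-by (ℤ.- (+ k ℤ.* + k ℤ.* (Yℤ *ℤ Yℤ) j))
    (trans (first-order-product c (ℤ.- c) Yℤ j) (lemma (oneℤ j) (Yℤ j) ((Yℤ *ℤ Yℤ) j) (+ k)))
    where
    lemma : ∀ o y w k → o ℤ.+ (+ 5 ℤ.* k ℤ.+ ℤ.- (+ 5 ℤ.* k)) ℤ.* y ℤ.+ + 5 ℤ.* k ℤ.* ℤ.- (+ 5 ℤ.* k) ℤ.* w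
                        ≡ o ℤ.+ + 25 ℤ.* ℤ.- (k ℤ.* k ℤ.* w)
    lemma = solve-∀

base-≋ : ∀ m k → base m k ≋ Yℤ^ m *ℤ (oneℤ +ℤ ℤ.- (+ 5 ℤ.* + k) ·ℤ Yℤ) [mod + 25 ]upTo 15
base-≋ m k = ≋-⊛ (≋-weaken-upTo (0-divisible (+ 25)) (≋-memo (≋-pow y-≋ m))) (inv-pow-onePlus5y-≋ k)

-- U⁽¹⁾ (G = F) and U⁽⁰⁾ (G = F Z) on integer models
Uℤ : ℤSeries → ℤSeries → ℤSeries
Uℤ G g = U5ℤ (G *ℤ g) *ℤ iFℤ

≋-U : ∀ {d F′ G f g} → F′ ≋ G [mod + 0 ]upTo 15 → f ≋ g [mod d ]upTo 15 →
      U5 (F′ ⊛ f) ⊛ inv F ≋ Uℤ G g [mod d ]upTo 3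
≋-U {d} {F′} {G} {f} {g} F′≋G f≋g =
  ≋-⊛ {f = U5 (F′ ⊛ f)} {f′ = inv F} {g = U5ℤ (G *ℤ g)} {g′ = iFℤ}
      (≋-U5 (≋-⊛ (≋-weaken-upTo (0-divisible d) F′≋G) f≋g))
      (≋-mono (s≤s (s≤s (s≤s z≤n))) (≋-weaken-upTo (0-divisible d) inv-F-≋))

Uℤ-cong : ∀ G {g g′} → (∀ n → g n ≡ g′ n) → ∀ j → Uℤ G g j ≡ Uℤ G g′ j
Uℤ-cong G {g} {g′} g≡g′ j =
  *ℤ-cong j {U5ℤ (G *ℤ g)} {U5ℤ (G *ℤ g′)} {iFℤ} {iFℤ}
    (λ k _ → *ℤ-cong (5 ℕ.* k) {G} {G} {g} {g′} (λ _ _ → refl) (λ n _ → g≡g′ n)) (λ _ _ → refl)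

Uℤ-linear : ∀ G a c b j → Uℤ G (a +ℤ c ·ℤ b) j ≡ (Uℤ G a +ℤ c ·ℤ Uℤ G b) j
Uℤ-linear G a c b j =
  trans (*ℤ-cong j {U5ℤ (G *ℤ (a +ℤ c ·ℤ b))} {U5ℤ (G *ℤ a) +ℤ c ·ℤ U5ℤ (G *ℤ b)} {iFℤ} {iFℤ}
                   (λ k _ → *ℤ-linearʳ G a c b (5 ℕ.* k)) (λ _ _ → refl))
        (*ℤ-linearˡ (U5ℤ (G *ℤ a)) c (U5ℤ (G *ℤ b)) iFℤ j)

U-base-≋ : ∀ {F′ G} → F′ ≋ G [mod + 0 ]upTo 15 → ∀ m k →
  U5 (F′ ⊛ base m k) ⊛ inv F
    ≋ Uℤ G (Yℤ^ m *ℤ oneℤ) +ℤ ℤ.- (+ 5 ℤ.* + k) ·ℤ Uℤ G (Yℤ^ m *ℤ Yℤ) [mod + 25 ]upTo 3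
U-base-≋ {G = G} F′≋G m k = ≋-resp-upTo (λ j _ → ≡⇒≡[mod] (trans
    (Uℤ-cong G (*ℤ-linearʳ (Yℤ^ m) oneℤ (ℤ.- (+ 5 ℤ.* + k)) Yℤ) j)
    (Uℤ-linear G (Yℤ^ m *ℤ oneℤ) (ℤ.- (+ 5 ℤ.* + k)) (Yℤ^ m *ℤ Yℤ) j)))
  (≋-U F′≋G (base-≋ m k))

-- Comparing coefficients with the right-hand sides

powerSumℤ : (ℕ → ℤSeries) → (ℕ → ℤ) → ℤSeries
powerSumℤ P w N = sumℤ N (λ r → w r ℤ.* P r N)

powerSum-unique : ∀ {d} J P w v → (∀ r → r ≤ J → P r r ≡ + 1) →
  (∀ j → j ≤ J → powerSumℤ P w j ≡ powerSumℤ P v j [mod d ]) → ∀ r → r ≤ J → w r ≡ v r [mod d ]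
powerSum-unique {d} J P w v diagonal system r r≤J = below r r≤J r ℕP.≤-refl
  where
  unit : ∀ {r} → r ≤ J → w r ℤ.* P r r ≡ v r ℤ.* P r r [mod d ] → w r ≡ v r [mod d ]
  unit {r} r≤J rewrite diagonal r r≤J | ℤP.*-identityʳ (w r) | ℤP.*-identityʳ (v r) = λ eq → eq
  below : ∀ j → j ≤ J → ∀ r → r ≤ j → w r ≡ v r [mod d ]
  below zero    0≤J   .zero z≤n = unit 0≤J (system 0 0≤J)
  below (suc j) 1+j≤J r    r≤1+j with ℕP.m≤n⇒m<n∨m≡n r≤1+j
  ... | inj₁ r<1+j = below j j≤J r (ℕP.≤-pred r<1+j)
    where j≤J = ℕP.≤-trans (ℕP.n≤1+n j) 1+j≤J
  ... | inj₂ refl  = unit 1+j≤J (mod-+-cancelˡ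
    (sumℤ-mod j (λ r r≤j → mod-* (below j j≤J r r≤j) (mod-refl (P r (suc j)))))
    (system (suc j) 1+j≤J))
    where j≤J = ℕP.≤-trans (ℕP.n≤1+n j) 1+j≤J

weighted : (ℕ → ℤ) → (ℕ → ℕ) → ℕ → ℕ → ℤ
weighted a w c r = if c ≤ᵇ r then a r ℤ.* + (5 ℕ.^ w r) else + 0

hSum-≋ : ∀ h π c m n →
  hSum h π c m n ≋ powerSumℤ (powℤ Yℤ) (weighted (λ r → h (+ m) (+ n) (+ r)) (π m) c) [mod + 0 ]upTo 15
hSum-≋ h π c m n = coefficientwise λ N N≤15 → ≋-sumTo N λ r _ → term r N N≤15 (c ≤ᵇ r)
  where
  term : ∀ r N → N ≤ 15 → ∀ b →
    (if b then ℤ→ℚ (h (+ m) (+ n) (+ r)) ℚ.* ℕ→ℚ (5 ℕ.^ π m r) ℚ.* pow y r N else 0ℚ)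
      ≋ (if b then h (+ m) (+ n) (+ r) ℤ.* + (5 ℕ.^ π m r) else + 0) ℤ.* powℤ Yℤ r N [mod + 0 ]
  term r N N≤15 true  =
    ≋-* (≋-* (≋-ℤ→ℚ (h (+ m) (+ n) (+ r))) (≋-ℤ→ℚ (+ (5 ℕ.^ π m r)))) (at (≋-pow y-≋ r) N N≤15)
  term r N N≤15 false = ≋-ℤ→ℚ (+ 0)

-- (1 + 5y)^{-e} ≡ 1 modulo 5 multiplies a sum divisible by w, so it disappears modulo 5w.
rhs-≋-powerSum : ∀ {w J} h π c m n e → J ≤ 15 → + 5 ℤ.* w ∣ + 25 →
  (∀ r → r ≤ J → c ≤ r → + (5 ℕ.^ π m r) ≡ w) → ∀ j → j ≤ J →
  (inv (pow onePlus5y e) ⊛ hSum h π c m n) j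
    ≋ powerSumℤ (powℤ Yℤ) (weighted (λ r → h (+ m) (+ n) (+ r)) (π m) c) j [mod + 5 ℤ.* w ]
rhs-≋-powerSum {w} {J} h π c m n e J≤15 5w∣25 constant j j≤J =
  ≋-resp negligible (≋-weaken 5w∣25 (at rhs-≋ j (ℕP.≤-trans j≤J J≤15)))
  where
  S = powerSumℤ (powℤ Yℤ) (weighted (λ r → h (+ m) (+ n) (+ r)) (π m) c)
  rhs-≋ : inv (pow onePlus5y e) ⊛ hSum h π c m n ≋ (oneℤ +ℤ ℤ.- (+ 5 ℤ.* + e) ·ℤ Yℤ) *ℤ S [mod + 25 ]upTo 15
  rhs-≋ = ≋-⊛ (inv-pow-onePlus5y-≋ e) (≋-weaken-upTo (0-divisible (+ 25)) (hSum-≋ h π c m n))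
  w∣weight : ∀ r → r ≤ J → w ∣ weighted (λ r → h (+ m) (+ n) (+ r)) (π m) c r
  w∣weight r r≤J with c ≤ᵇ r in c≤ᵇr
  ... | false = 0-divisible w
  ... | true  = ∣n⇒∣m*n (h (+ m) (+ n) (+ r)) (∣-reflexive (sym (constant r r≤J c≤r)))
    where c≤r = ℕP.≤ᵇ⇒≤ c r (subst T (sym c≤ᵇr) tt)
  w∣S : ∀ k → k ≤ j → w ∣ S k
  w∣S k k≤j = ∣-sumℤ k λ r r≤k → ∣m⇒∣m*n _ (w∣weight r (ℕP.≤-trans r≤k (ℕP.≤-trans k≤j j≤J)))
  factor≡1 : ∀ k → (oneℤ +ℤ ℤ.- (+ 5 ℤ.* + e) ·ℤ Yℤ) k ≡ oneℤ k [mod + 5 ]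
  factor≡1 k = mod-by (ℤ.- (+ e ℤ.* Yℤ k)) (lemma (oneℤ k) (+ e) (Yℤ k))
    where
    lemma : ∀ o e y → o ℤ.+ ℤ.- (+ 5 ℤ.* e) ℤ.* y ≡ o ℤ.+ + 5 ℤ.* ℤ.- (e ℤ.* y)
    lemma = solve-∀
  negligible : ((oneℤ +ℤ ℤ.- (+ 5 ℤ.* + e) ·ℤ Yℤ) *ℤ S) j ≡ S j [mod + 5 ℤ.* w ]
  negligible = mod-trans (*ℤ-mod-∣ {+ 5} {w} j {a′ = oneℤ} {S} (λ k _ → factor≡1 k) w∣S)
                         (≡⇒≡[mod] (*ℤ-identityˡ S j))

Yℤ-diagonal : ∀ r → r ≤ 3 → powℤ Yℤ r r ≡ + 1
Yℤ-diagonal = byComputation (λ r → powℤ Yℤ r r ℤ.≟ + 1) 3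

weighted-≥ : ∀ a w c r → c ≤ r → weighted a w c r ≡ a r ℤ.* + (5 ℕ.^ w r)
weighted-≥ a w c r c≤r with c ≤ᵇ r | ℕP.≤⇒≤ᵇ c≤r
... | true | _ = refl

hSum-congruence : ∀ {w} .{{_ : ℤ.NonZero w}} {J f L} h t π c m n e → J ≤ 3 → + 5 ℤ.* w ∣ + 25 →
  (∀ r → r ≤ J → c ≤ r → + (5 ℕ.^ π m r) ≡ w) →
  f ≋ L [mod + 5 ℤ.* w ]upTo J →
  f ≈ inv (pow onePlus5y e) ⊛ hSum h π c m n →
  (∀ j → j ≤ J → powerSumℤ (powℤ Yℤ) (weighted t (π m) c) j ≡ L j [mod + 5 ℤ.* w ]) →
  ∀ r → r ≤ J → c ≤ r → h (+ m) (+ n) (+ r) ≡ t r [mod + 5 ]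
hSum-congruence {w} {J} h t π c m n e J≤3 5w∣25 constant f≋L f≈rhs solution r r≤J c≤r =
  mod-cancelʳ w (subst₂ (λ x y → x ≡ y [mod + 5 ℤ.* w ]) (weight a) (weight t)
    (powerSum-unique J (powℤ Yℤ) (weighted a (π m) c) (weighted t (π m) c)
                     (λ r r≤J → Yℤ-diagonal r (ℕP.≤-trans r≤J J≤3)) system r r≤J))
  where
  a = λ r → h (+ m) (+ n) (+ r)
  weight : ∀ x → weighted x (π m) c r ≡ x r ℤ.* w
  weight x = trans (weighted-≥ x (π m) c r c≤r) (cong (x r ℤ.*_) (constant r r≤J c≤r))
  system : ∀ j → j ≤ J → powerSumℤ (powℤ Yℤ) (weighted a (π m) c) j
                         ≡ powerSumℤ (powℤ Yℤ) (weighted t (π m) c) j [mod + 5 ℤ.* w ]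
  system j j≤J = mod-trans
    (≋-unique (subst (_≋ _ [mod + 5 ℤ.* w ]) (sym (f≈rhs j))
                     (rhs-≋-powerSum h π c m n e (ℕP.≤-trans J≤3 (ℕP.m≤m+n 3 12)) 5w∣25 constant j j≤J))
              (at f≋L j j≤J))
    (mod-sym (solution j j≤J))

-- Modulo 25 the left-hand side is A + c B with c = -5k; once c is replaced by a
-- constant c′ congruent enough to it, everything left is checked by computation.
U-congruences : ∀ {w} .{{_ : ℤ.NonZero w}} {d₁} d₂ {F′} G J h t π c m k e c′ →
  F′ ≋ G [mod + 0 ]upTo 15 → J ≤ 3 → + 5 ℤ.* w ∣ + 25 → d₁ ℤ.* d₂ ≡ + 5 ℤ.* w →
  d₁ ∣ ℤ.- (+ 5 ℤ.* + k) ℤ.- c′ →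
  {True (ℕP.allUpTo? (constant? π c m w) (suc J))} →
  {True (ℕP.allUpTo? (divisible? d₂ (Uℤ G (Yℤ^ m *ℤ Yℤ))) (suc J))} →
  {True (ℕP.allUpTo? (congruent? (+ 5 ℤ.* w) (powerSumℤ (powℤ Yℤ) (weighted t (π m) c))
                                 (Uℤ G (Yℤ^ m *ℤ oneℤ) +ℤ c′ ·ℤ Uℤ G (Yℤ^ m *ℤ Yℤ))) (suc J))} →
  U5 (F′ ⊛ base m k) ⊛ inv F ≈ inv (pow onePlus5y e) ⊛ hSum h π c m k →
  ∀ r → r ≤ J → c ≤ r → h (+ m) (+ k) (+ r) ≡ t r [mod + 5 ]
U-congruences {w} d₂ G J h t π c m k e c′ F′≋G J≤3 5w∣25 d₁d₂≡5w d₁∣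
              {constant} {d₂∣} {solution} U≈rhs =
  hSum-congruence h t π c m k e J≤3 5w∣25 (byComputation (constant? π c m w) J {constant})
    (≋-resp-upTo {g = A +ℤ ℤ.- (+ 5 ℤ.* + k) ·ℤ B} reduce
                 (≋-mono J≤3 (≋-weaken-upTo 5w∣25 (U-base-≋ F′≋G m k))))
    U≈rhs (byComputation (congruent? (+ 5 ℤ.* w) (powerSumℤ (powℤ Yℤ) (weighted t (π m) c)) _) J {solution})
  where
  A = Uℤ G (Yℤ^ m *ℤ oneℤ)
  B = Uℤ G (Yℤ^ m *ℤ Yℤ)
  reduce : ∀ j → j ≤ J → (A +ℤ ℤ.- (+ 5 ℤ.* + k) ·ℤ B) j ≡ (A +ℤ c′ ·ℤ B) j [mod + 5 ℤ.* w ]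
  reduce j j≤J = mod-weaken (∣-reflexive (sym d₁d₂≡5w))
    (lin-congruence A (ℤ.- (+ 5 ℤ.* + k)) c′ B d₁∣ (byComputation (divisible? d₂ B) J {d₂∣}) j j≤J)

5∣-5k : ∀ k → + 5 ∣ ℤ.- (+ 5 ℤ.* k) ℤ.- + 0
5∣-5k k = divides (ℤ.- k) (lemma k)
  where
  lemma : ∀ k → ℤ.- (+ 5 ℤ.* k) ℤ.- + 0 ≡ ℤ.- k ℤ.* + 5
  lemma = solve-∀

5n-4≡1+5n : ∀ n → + (5 ℕ.* suc n ∸ 4) ≡ + 1 ℤ.+ + 5 ℤ.* + n
5n-4≡1+5n n = trans (cong (λ x → + (x ∸ 4)) (ℕP.*-suc 5 n))
                    (trans (ℤP.pos-+ 1 (5 ℕ.* n)) (cong (λ x → + 1 ℤ.+ x) (ℤP.pos-* 5 n)))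

25∣-5[5n-4]+5 : ∀ n → + 25 ∣ ℤ.- (+ 5 ℤ.* + (5 ℕ.* suc n ∸ 4)) ℤ.- ℤ.- + 5
25∣-5[5n-4]+5 n = subst (λ x → + 25 ∣ ℤ.- (+ 5 ℤ.* x) ℤ.- ℤ.- + 5) (sym (5n-4≡1+5n n))
                        (divides (ℤ.- + n) (lemma (+ n)))
  where
  lemma : ∀ n → ℤ.- (+ 5 ℤ.* (+ 1 ℤ.+ + 5 ℤ.* n)) ℤ.- ℤ.- + 5 ≡ ℤ.- n ℤ.* + 25
  lemma = solve-∀

-- In each case w = 5^π on 1 ≤ r ≤ J (w = 1 for h₁ and h₀(3, n, r), w = 5 for h₀(1, n, r) and
-- h₀(2, 5n − 4, r)), and c′ = 0 except for h₀(2, 5n − 4, r), where k ≡ 1 modulo 5 gives c′ = −5.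
h₁-congruence : ∀ (h : Array) m n → 1 ≤ m → m ≤ 3 → U⁽¹⁾ (base m n) ≈ rhs₁ h m n →
                h (+ m) (+ n) (+ 1) ≡ + 1 [mod + 5 ]
h₁-congruence h 1 n _ _ H = U-congruences {+ 1} (+ 1) Fℤ 1 h (λ _ → + 1) π₁ 1 1 n (5 ℕ.* n ∸ 4) (+ 0)
  F-≋ (s≤s z≤n) (divides (+ 5) refl) refl (5∣-5k (+ n)) H 1 ℕP.≤-refl ℕP.≤-refl
h₁-congruence h 2 n _ _ H = U-congruences {+ 1} (+ 1) Fℤ 1 h (λ _ → + 1) π₁ 1 2 n (5 ℕ.* n ∸ 4) (+ 0)
  F-≋ (s≤s z≤n) (divides (+ 5) refl) refl (5∣-5k (+ n)) H 1 ℕP.≤-refl ℕP.≤-refl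
h₁-congruence h 3 n _ _ H = U-congruences {+ 1} (+ 1) Fℤ 1 h (λ _ → + 1) π₁ 1 3 n (5 ℕ.* n ∸ 4) (+ 0)
  F-≋ (s≤s z≤n) (divides (+ 5) refl) refl (5∣-5k (+ n)) H 1 ℕP.≤-refl ℕP.≤-refl
h₁-congruence h (suc (suc (suc (suc _)))) n _ (s≤s (s≤s (s≤s ()))) _

h₀-congruences-m1 : ∀ (h : Array) n → U⁽⁰⁾ (base 1 n) ≈ rhs₀ h 1 n →
  ∀ r → r ≤ 2 → 1 ≤ r → h (+ 1) (+ n) (+ r) ≡ fromListℤ (+ 0 ∷ + 1 ∷ + 4 ∷ []) r [mod + 5 ]
h₀-congruences-m1 h n = U-congruences {+ 5} (+ 5) FZℤ 2 h (fromListℤ (+ 0 ∷ + 1 ∷ + 4 ∷ [])) π₀ 1 1 n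
  (5 ℕ.* n ∸ 2) (+ 0) FZ-≋ (s≤s (s≤s z≤n)) (divides (+ 1) refl) refl (5∣-5k (+ n))

h₀-congruences-m3 : ∀ (h : Array) n → U⁽⁰⁾ (base 3 n) ≈ rhs₀ h 3 n →
  ∀ r → r ≤ 2 → 1 ≤ r → h (+ 3) (+ n) (+ r) ≡ fromListℤ (+ 0 ∷ + 1 ∷ + 4 ∷ []) r [mod + 5 ]
h₀-congruences-m3 h n = U-congruences {+ 1} (+ 1) FZℤ 2 h (fromListℤ (+ 0 ∷ + 1 ∷ + 4 ∷ [])) π₀ 1 3 n
  (5 ℕ.* n ∸ 2) (+ 0) FZ-≋ (s≤s (s≤s z≤n)) (divides (+ 5) refl) refl (5∣-5k (+ n))

h₀-congruences-m2 : ∀ (h : Array) n → let k = 5 ℕ.* suc n ∸ 4 in U⁽⁰⁾ (base 2 k) ≈ rhs₀ h 2 k →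
  ∀ r → r ≤ 3 → 1 ≤ r → h (+ 2) (+ k) (+ r) ≡ fromListℤ (+ 0 ∷ + 0 ∷ + 4 ∷ + 1 ∷ []) r [mod + 5 ]
h₀-congruences-m2 h n = U-congruences {+ 5} (+ 1) FZℤ 3 h (fromListℤ (+ 0 ∷ + 0 ∷ + 4 ∷ + 1 ∷ [])) π₀ 1 2 k
  (5 ℕ.* k ∸ 2) (ℤ.- + 5) FZ-≋ (s≤s (s≤s (s≤s z≤n))) (divides (+ 1) refl) refl (25∣-5[5n-4]+5 n)
  where k = 5 ℕ.* suc n ∸ 4

toMod5 : ∀ {a b} → a ≡ b [mod + 5 ] → a ≡ b [mod5]
toMod5 (congruent 5∣a-b) = ∣⇒∣ᵤ 5∣a-b

h₀-congruences : ∀ (h : Array) → (∀ m n → 1 ≤ m → 1 ≤ n → U⁽⁰⁾ (base m n) ≈ rhs₀ h m n) →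
  ∀ n → 1 ≤ n
    → (h (+ 1) (+ n) (+ 1) ≡ + 1 [mod5])
    × (h (+ 2) (+ (5 * n ∸ 4)) (+ 1) ≡ + 0 [mod5])
    × (h (+ 3) (+ n) (+ 1) ≡ + 1 [mod5])
    × (h (+ 1) (+ n) (+ 2) ≡ + 4 [mod5])
    × (h (+ 2) (+ (5 * n ∸ 4)) (+ 2) ≡ + 4 [mod5])
    × (h (+ 3) (+ n) (+ 2) ≡ + 4 [mod5])
    × (h (+ 2) (+ (5 * n ∸ 4)) (+ 3) ≡ + 1 [mod5])
h₀-congruences h U⁽⁰⁾-hyp (suc n) _ =
  toMod5 (m=1 1 1≤2 ℕP.≤-refl) , toMod5 (m=2 1 1≤3 ℕP.≤-refl) , toMod5 (m=3 1 1≤2 ℕP.≤-refl) ,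
  toMod5 (m=1 2 ℕP.≤-refl 1≤2) , toMod5 (m=2 2 2≤3 1≤2) , toMod5 (m=3 2 ℕP.≤-refl 1≤2) ,
  toMod5 (m=2 3 ℕP.≤-refl 1≤3)
  where
  1≤2 : 1 ≤ 2
  1≤2 = s≤s z≤n
  1≤3 : 1 ≤ 3
  1≤3 = s≤s z≤n
  2≤3 : 2 ≤ 3
  2≤3 = s≤s (s≤s z≤n)
  m=1 = h₀-congruences-m1 h (suc n) (U⁽⁰⁾-hyp 1 (suc n) (s≤s z≤n) (s≤s z≤n))
  m=3 = h₀-congruences-m3 h (suc n) (U⁽⁰⁾-hyp 3 (suc n) (s≤s z≤n) (s≤s z≤n))
  m=2 = h₀-congruences-m2 h n (U⁽⁰⁾-hyp 2 (5 * suc n ∸ 4) (s≤s z≤n)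
          (subst (1 ≤_) (sym (cong (_∸ 4) (ℕP.*-suc 5 n))) (s≤s z≤n)))

corollary3p6 : (h₀ h₁ : Array) → DiscreteArray h₀ → DiscreteArray h₁
    → (∀ (m n : ℕ) → 1 ≤ m → 1 ≤ n → U⁽¹⁾ (base m n) ≈ rhs₁ h₁ m n)
    → (∀ (m n : ℕ) → 1 ≤ m → 1 ≤ n → U⁽⁰⁾ (base m n) ≈ rhs₀ h₀ m n)
    → (∀ (n : ℕ) → 1 ≤ n
         → (h₀ (+ 1) (+ n) (+ 1) ≡ + 1 [mod5])
         × (h₀ (+ 2) (+ (5 * n ∸ 4)) (+ 1) ≡ + 0 [mod5])
         × (h₀ (+ 3) (+ n) (+ 1) ≡ + 1 [mod5])
         × (h₀ (+ 1) (+ n) (+ 2) ≡ + 4 [mod5])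
         × (h₀ (+ 2) (+ (5 * n ∸ 4)) (+ 2) ≡ + 4 [mod5])
         × (h₀ (+ 3) (+ n) (+ 2) ≡ + 4 [mod5])
         × (h₀ (+ 2) (+ (5 * n ∸ 4)) (+ 3) ≡ + 1 [mod5]))
      × (∀ (n m : ℕ) → 1 ≤ n → 1 ≤ m → m ≤ 3 → h₁ (+ m) (+ n) (+ 1) ≡ + 1 [mod5])
corollary3p6 h₀ h₁ _ _ U⁽¹⁾-hyp U⁽⁰⁾-hyp =
  h₀-congruences h₀ U⁽⁰⁾-hyp ,
  λ n m 1≤n 1≤m m≤3 → toMod5 (h₁-congruence h₁ m n 1≤m m≤3 (U⁽¹⁾-hyp m n 1≤m 1≤n))
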